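{- Let $n,k\ge 1$ be integers and let $G_{2n+1}(k+1)$ be the simple graph with vertex set $$\{u_i, v_i : 1\le i\le 2k+1\}\cup\{y_{i,j}, z_{i,j} : 1\le i\le k,\ 1\le j\le 2n+1\}\cup\{x_{k+1,j} : 1\le j\le 2n+1\}$$ and edge set consisting of - $u_iv_i$ for $1\le i\le 2k+1$; - $u_iy_{i,j}$, $v_{2k+2-i}y_{i,j}$, $v_iz_{i,j}$, $u_{2k+2-i}z_{i,j}$ for $1\le i\le k$ and $1\le j\le 2n+1$; - $u_{k+1}x_{k+1,j}$, $v_{k+1}x_{k+1,j}$ for $1\le j\le 2n+1$. This graph has $k+1$ components, the $(k+1)$-st being a copy of $P_2\vee O_{2n+1}$. Then $\chi_{la}(G_{2n+1}(k+1))=3$.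
   Context: For a graph $G$ with $q$ edges, a local antimagic labeling is a bijection $f:E(G)\to\{1,2,\dots,q\}$ such that $f^+(u)\ne f^+(v)$ for every edge $uv\in E(G)$. Here $f^+(u)=\sum_{e\ni u} f(e)$ is the sum of the labels of the edges incident to $u$. The color number of $f$ is the number of distinct values of $f^+$. The local antimagic chromatic number $\chi_{la}(G)$ is the minimum color number over all local antimagic labelings of $G$. $P_2\vee O_m$ denotes the join of an edge with an edgeless graph on $m$ vertices. -}

module Defs where

open import Data.Nat using (ℕ; zero; suc; _+_; _*_; _∸_; _≤_)
import Data.Nat as ℕ
open import Data.Fin using (Fin; toℕ)
open import Data.List using (List; []; _∷_; map; concatMap; length; upTo; allFin; deduplicate; lookup)
open import Data.Nat.ListAction using (sum)
open import Data.List.Membership.Propositional using (_∈_)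
open import Data.Product using (_×_; _,_; proj₁; proj₂; Σ; ∃)
open import Data.Sum using (_⊎_)
open import Relation.Nullary using (¬_; Dec; yes; no)
open import Relation.Nullary.Decidable using (_⊎-dec_)
open import Relation.Binary.PropositionalEquality using (_≡_; _≢_; refl; cong; cong₂)
open import Relation.Binary.Definitions using (DecidableEquality)
open import Function.Definitions using (Bijective)

record Graph : Set₁ where
  field
    V     : Set
    _≟V_  : DecidableEquality V
    verts : List V
    edges : List (V × V)      -- edges, each listed once

module _ (G : Graph) where
  open Graph G

  q : ℕ
  q = length edges

  -- A labeling f : E → {1..q} bijective, represented by a bijection
  -- g : Fin q → Fin q, the label of edge e being 1 + toℕ (g e).
  Labeling : Set
  Labeling = Σ (Fin q → Fin q) λ g → Bijective _≡_ _≡_ g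

  label : Labeling → Fin q → ℕ
  label (g , _) e = suc (toℕ (g e))

  vsum : Labeling → V → ℕ
  vsum f w = sum (map term (allFin q))
    where
      term : Fin q → ℕ
      term e with (w ≟V proj₁ (lookup edges e)) ⊎-dec (w ≟V proj₂ (lookup edges e))
      ... | yes _ = label f e
      ... | no  _ = 0

  IsLocalAntimagic : Labeling → Set
  IsLocalAntimagic f = ∀ {a b} → (a , b) ∈ edges → vsum f a ≢ vsum f b

  colorNumber : Labeling → ℕ
  colorNumber f = length (deduplicate ℕ._≟_ (map (vsum f) verts))

  ChiLA≡ : ℕ → Set
  ChiLA≡ c = (∃ λ f → IsLocalAntimagic f × colorNumber f ≡ c)
           × (∀ f → IsLocalAntimagic f → c ≤ colorNumber f)

-- The graph G_{2n+1}(k+1); indices are 1-based natural numbers.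
-- x j stands for x_{k+1,j}.

data Vtx : Set where
  u v : ℕ → Vtx
  y z : ℕ → ℕ → Vtx
  x   : ℕ → Vtx

_≟Vtx_ : DecidableEquality Vtx
u i ≟Vtx u i' with i ℕ.≟ i'
... | yes refl = yes refl
... | no ne = no λ { refl → ne refl }
v i ≟Vtx v i' with i ℕ.≟ i'
... | yes refl = yes refl
... | no ne = no λ { refl → ne refl }
x i ≟Vtx x i' with i ℕ.≟ i'
... | yes refl = yes refl
... | no ne = no λ { refl → ne refl }
y i j ≟Vtx y i' j' with i ℕ.≟ i' | j ℕ.≟ j'
... | yes refl | yes refl = yes refl
... | no ne | _ = no λ { refl → ne refl }
... | _ | no ne = no λ { refl → ne refl }
z i j ≟Vtx z i' j' with i ℕ.≟ i' | j ℕ.≟ j'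
... | yes refl | yes refl = yes refl
... | no ne | _ = no λ { refl → ne refl }
... | _ | no ne = no λ { refl → ne refl }
u _ ≟Vtx v _ = no λ ()
u _ ≟Vtx y _ _ = no λ ()
u _ ≟Vtx z _ _ = no λ ()
u _ ≟Vtx x _ = no λ ()
v _ ≟Vtx u _ = no λ ()
v _ ≟Vtx y _ _ = no λ ()
v _ ≟Vtx z _ _ = no λ ()
v _ ≟Vtx x _ = no λ ()
y _ _ ≟Vtx u _ = no λ ()
y _ _ ≟Vtx v _ = no λ ()
y _ _ ≟Vtx z _ _ = no λ ()
y _ _ ≟Vtx x _ = no λ ()
z _ _ ≟Vtx u _ = no λ ()
z _ _ ≟Vtx v _ = no λ ()
z _ _ ≟Vtx y _ _ = no λ ()
z _ _ ≟Vtx x _ = no λ ()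
x _ ≟Vtx u _ = no λ ()
x _ ≟Vtx v _ = no λ ()
x _ ≟Vtx y _ _ = no λ ()
x _ ≟Vtx z _ _ = no λ ()

range1 : ℕ → List ℕ
range1 m = map suc (upTo m)

GVerts : ℕ → ℕ → List Vtx
GVerts n k =
     concatMap (λ i → u i ∷ v i ∷ []) (range1 (2 * k + 1))
  Data.List.++ concatMap (λ i → concatMap (λ j → y i j ∷ z i j ∷ []) (range1 (2 * n + 1))) (range1 k)
  Data.List.++ map x (range1 (2 * n + 1))

GEdges : ℕ → ℕ → List (Vtx × Vtx)
GEdges n k =
     map (λ i → (u i , v i)) (range1 (2 * k + 1))
  Data.List.++ concatMap (λ i → concatMap (λ j →
          (u i , y i j) ∷ (v (2 * k + 2 ∸ i) , y i j)
        ∷ (v i , z i j) ∷ (u (2 * k + 2 ∸ i) , z i j) ∷ [])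
        (range1 (2 * n + 1))) (range1 k)
  Data.List.++ concatMap (λ j → (u (k + 1) , x j) ∷ (v (k + 1) , x j) ∷ []) (range1 (2 * n + 1))

G : ℕ → ℕ → Graph
G n k = record { V = Vtx ; _≟V_ = _≟Vtx_ ; verts = GVerts n k ; edges = GEdges n k }

-- Every middle vertex (y_{i,j}, z_{i,j} or x_{k+1,j}) is adjacent to exactly one u_a and to
-- v_{2k+2-a}; indexing it by this "column" a ∈ [1, 2k+1] and by j ∈ [1, 2n+1], the graph
-- consists of the rungs u_a v_a and the paths u_a – mid a j – v_{2k+2-a}.  With K = 2k+1 and
-- N = 2n+1 there are q = (2N+1)K edges, and the labels are the cells r K + col of a
-- (2N+1) × K table: row 0 labels the rungs, and mid a j receives the cells (j, a) and
-- (2N+1-j, 2k+2-a), whose sum midSum does not depend on (a, j).  Which of the two goes to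
-- the u-edge alternates with the parity of j; pairing j = 2p with 2p+1 then gives every u_a
-- the same sum uSum and every v_b the same sum vSum, and midSum < vSum < uSum when n ≥ 1.
-- The triangle u_{k+1} v_{k+1} x_{k+1,1} forces three colours for every local antimagic
-- labeling.

module Submission where

open import Data.Bool using (Bool; true; false; if_then_else_)
open import Data.Empty using (⊥-elim)
open import Data.Fin using (Fin; zero; suc; punchOut; toℕ; fromℕ<)
open import Data.Fin.Properties
  using (any?; punchOut-injective; injective⇒≤; toℕ-fromℕ<; toℕ-injective; toℕ<n)
  renaming (_≟_ to _≟ᶠ_)
open import Data.List
  using (List; []; _∷_; _++_; [_]; map; concatMap; length; upTo; allFin; lookup;
         deduplicate; tabulate)
open import Data.List.Membership.Propositional using (_∈_; lose)
open import Data.List.Membership.Propositional.Properties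
  using (∈-lookup; ∈-map⁺; ∈-map⁻; ∈-deduplicate⁺; ∈-deduplicate⁻; ∈-upTo⁺; ∈-++⁺ˡ; ∈-++⁺ʳ;
         ∈-concatMap⁺)
open import Data.List.Properties
  using (map-cong; map-∘; map-++; map-tabulate; tabulate-lookup; applyUpTo-∷ʳ)
open import Data.List.Relation.Binary.Subset.Propositional using (_⊆_)
open import Data.List.Relation.Unary.All as All using (All; []; _∷_)
open import Data.List.Relation.Unary.All.Properties using (++⁺; map⁺; concat⁺; applyUpTo⁺₁)
open import Data.List.Relation.Unary.AllPairs using ([]; _∷_)
open import Data.List.Relation.Unary.Any using (here; there; index)
open import Data.List.Relation.Unary.Any.Properties using (lookup-index)
open import Data.List.Relation.Unary.Unique.Propositional using (Unique)
import Data.List.Relation.Unary.Unique.DecPropositional.Properties as DecUnique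
open import Data.Nat
open import Data.Nat.DivMod using (_/_; _%_; m%n<n; m<n*o⇒m/o<n; m≡m%n+[m/n]*n)
open import Data.Nat.ListAction using (sum)
open import Data.Nat.ListAction.Properties using (sum-++)
open import Data.Nat.Properties
open import Algebra.Properties.CommutativeSemigroup +-commutativeSemigroup using (interchange)
open import Data.Nat.Tactic.RingSolver using (solve-∀)
open import Data.Product using (_×_; _,_; proj₁; proj₂; ∃; ∃₂)
open import Data.Sum using (_⊎_; inj₁; inj₂)
open import Function using (_∘_)
open import Function.Definitions using (Injective; StrictlySurjective; Bijective)
open import Relation.Binary.Definitions using (tri<; tri≈; tri>)
open import Relation.Binary.PropositionalEquality
  using (_≡_; _≢_; refl; sym; trans; cong; cong₂; subst; subst₂; module ≡-Reasoning)
open import Relation.Nullary using (yes; no)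
open import Relation.Nullary.Decidable using (_⊎-dec_)

open import Defs

injective⇒strictlySurjective : ∀ {m} {h : Fin m → Fin m} →
  Injective _≡_ _≡_ h → StrictlySurjective _≡_ h
injective⇒strictlySurjective {suc m} {h} h-injective t with any? (λ s → h s ≟ᶠ t)
... | yes hit = hit
... | no miss = ⊥-elim (<-irrefl refl (injective⇒≤ punchOut∘h-injective))
  where
  avoids : ∀ s → t ≢ h s
  avoids s t≡hs = miss (s , sym t≡hs)
  punchOut∘h-injective : Injective _≡_ _≡_ (λ s → punchOut (avoids s))
  punchOut∘h-injective eq = h-injective (punchOut-injective (avoids _) (avoids _) eq)

strictlySurjective⇒bijective : ∀ {m} {g : Fin m → Fin m} →
  StrictlySurjective _≡_ g → Bijective _≡_ _≡_ g
strictlySurjective⇒bijective {m} {g} g-onto = g-injective , λ t → section t , λ { refl → g∘section t }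
  where
  section : Fin m → Fin m
  section t = proj₁ (g-onto t)
  g∘section : ∀ t → g (section t) ≡ t
  g∘section t = proj₂ (g-onto t)
  section-injective : Injective _≡_ _≡_ section
  section-injective {a} {b} eq = trans (sym (g∘section a)) (trans (cong g eq) (g∘section b))
  g-injective : Injective _≡_ _≡_ g
  g-injective {a} {b} eq
    with injective⇒strictlySurjective section-injective a
       | injective⇒strictlySurjective section-injective b
  ... | a′ , refl | b′ , refl = cong section (trans (sym (g∘section a′)) (trans eq (g∘section b′)))

module _ {A : Set} where

  lookup-injective : ∀ {xs : List A} → Unique xs → Injective _≡_ _≡_ (lookup xs)
  lookup-injective {_ ∷ _} _ {zero} {zero} _ = refl
  lookup-injective {_ ∷ _} (x∉xs ∷ _) {zero} {suc j} eq = ⊥-elim (All.lookup x∉xs (∈-lookup j) eq)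
  lookup-injective {_ ∷ _} (x∉xs ∷ _) {suc i} {zero} eq = ⊥-elim (All.lookup x∉xs (∈-lookup i) (sym eq))
  lookup-injective {_ ∷ _} (_ ∷ xs!) {suc i} {suc j} eq = cong suc (lookup-injective xs! eq)

  Unique-⊆⇒length≤ : ∀ {xs ys : List A} → Unique xs → xs ⊆ ys → length xs ≤ length ys
  Unique-⊆⇒length≤ {xs} {ys} xs! xs⊆ys = injective⇒≤ position-injective
    where
    position : Fin (length xs) → Fin (length ys)
    position i = index (xs⊆ys (∈-lookup i))
    position-injective : Injective _≡_ _≡_ position
    position-injective {i} {j} eq = lookup-injective xs! (begin
      lookup xs i                ≡⟨ lookup-index (xs⊆ys (∈-lookup i)) ⟩
      lookup ys (position i)     ≡⟨ cong (lookup ys) eq ⟩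
      lookup ys (position j)     ≡⟨ lookup-index (xs⊆ys (∈-lookup j)) ⟨
      lookup xs j                ∎)
      where open ≡-Reasoning

∑ : ℕ → (ℕ → ℕ) → ℕ
∑ zero    f = 0
∑ (suc m) f = ∑ m f + f (suc m)

syntax ∑ m (λ i → e) = ∑[ i ≤ m ] e

sum-concatMap : ∀ {A B : Set} (g : B → ℕ) (h : A → List B) xs →
  sum (map g (concatMap h xs)) ≡ sum (map (λ s → sum (map g (h s))) xs)
sum-concatMap g h [] = refl
sum-concatMap g h (s ∷ xs) = begin
  sum (map g (h s ++ concatMap h xs))               ≡⟨ cong sum (map-++ g (h s) _) ⟩
  sum (map g (h s) ++ map g (concatMap h xs))       ≡⟨ sum-++ (map g (h s)) _ ⟩
  sum (map g (h s)) + sum (map g (concatMap h xs))  ≡⟨ cong (sum (map g (h s)) +_) (sum-concatMap g h xs) ⟩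
  sum (map g (h s)) + sum (map (λ s → sum (map g (h s))) xs) ∎
  where open ≡-Reasoning

range1-suc : ∀ m → range1 (suc m) ≡ range1 m ++ [ suc m ]
range1-suc m = trans (cong (map suc) (sym (applyUpTo-∷ʳ (λ i → i) m))) (map-++ suc (upTo m) [ m ])

sum-range1 : ∀ m f → sum (map f (range1 m)) ≡ ∑ m f
sum-range1 zero f = refl
sum-range1 (suc m) f = begin
  sum (map f (range1 (suc m)))              ≡⟨ cong (sum ∘ map f) (range1-suc m) ⟩
  sum (map f (range1 m ++ [ suc m ]))       ≡⟨ cong sum (map-++ f (range1 m) [ suc m ]) ⟩
  sum (map f (range1 m) ++ [ f (suc m) ])   ≡⟨ sum-++ (map f (range1 m)) [ f (suc m) ] ⟩
  sum (map f (range1 m)) + (f (suc m) + 0)  ≡⟨ cong₂ _+_ (sum-range1 m f) (+-identityʳ (f (suc m))) ⟩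
  ∑ m f + f (suc m)                         ∎
  where open ≡-Reasoning

∑-cong : ∀ m {f g : ℕ → ℕ} → (∀ {i} → 1 ≤ i → i ≤ m → f i ≡ g i) → ∑ m f ≡ ∑ m g
∑-cong zero    _   = refl
∑-cong (suc m) f≗g =
  cong₂ _+_ (∑-cong m (λ 1≤i i≤m → f≗g 1≤i (m≤n⇒m≤1+n i≤m))) (f≗g (s≤s z≤n) ≤-refl)

∑-zero : ∀ m {f : ℕ → ℕ} → (∀ {i} → 1 ≤ i → i ≤ m → f i ≡ 0) → ∑ m f ≡ 0
∑-zero zero    _  = refl
∑-zero (suc m) f≗0 =
  cong₂ _+_ (∑-zero m (λ 1≤i i≤m → f≗0 1≤i (m≤n⇒m≤1+n i≤m))) (f≗0 (s≤s z≤n) ≤-refl)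

∑-const : ∀ m c → ∑[ i ≤ m ] c ≡ m * c
∑-const zero    c = refl
∑-const (suc m) c = trans (cong (_+ c) (∑-const m c)) (+-comm (m * c) c)

∑-+ : ∀ m (f g : ℕ → ℕ) → ∑[ i ≤ m ] (f i + g i) ≡ ∑ m f + ∑ m g
∑-+ zero    f g = refl
∑-+ (suc m) f g = trans (cong (_+ (f (suc m) + g (suc m))) (∑-+ m f g))
                        (interchange (∑ m f) (∑ m g) (f (suc m)) (g (suc m)))

∑-single : ∀ m {f : ℕ → ℕ} {a} → 1 ≤ a → a ≤ m →
  (∀ {i} → 1 ≤ i → i ≤ m → i ≢ a → f i ≡ 0) → ∑ m f ≡ f a
∑-single zero    (s≤s _) ()
∑-single (suc m) {f} {a} 1≤a a≤1+m f≗0 with m≤n⇒m<n∨m≡n a≤1+m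
... | inj₁ (s≤s a≤m) = begin
  ∑ m f + f (suc m) ≡⟨ cong₂ _+_ (∑-single m 1≤a a≤m λ 1≤i i≤m → f≗0 1≤i (m≤n⇒m≤1+n i≤m))
                                 (f≗0 (s≤s z≤n) ≤-refl λ 1+m≡a → <⇒≢ (s≤s a≤m) (sym 1+m≡a)) ⟩
  f a + 0           ≡⟨ +-identityʳ (f a) ⟩
  f a               ∎
  where open ≡-Reasoning
... | inj₂ refl = cong (_+ f (suc m)) (∑-zero m λ 1≤i i≤m → f≗0 1≤i (m≤n⇒m≤1+n i≤m) (<⇒≢ (s≤s i≤m)))

∑-cons : ∀ m f → ∑ (suc m) f ≡ f 1 + ∑[ i ≤ m ] f (suc i)
∑-cons zero    f = +-comm 0 (f 1)
∑-cons (suc m) f = trans (cong (_+ f (suc (suc m))) (∑-cons m f)) (+-assoc (f 1) _ _)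

∑-fold : ∀ k h → ∑ (2 * k + 1) h ≡ ∑[ i ≤ k ] (h i + h (2 * k + 2 ∸ i)) + h (k + 1)
∑-fold k h rewrite +-comm (2 * k) 1 | +-comm (2 * k) 2 | +-comm k 1 = fold k h
  where
  fold : ∀ k h → ∑ (suc (2 * k)) h ≡ ∑[ i ≤ k ] (h i + h (suc (suc (2 * k)) ∸ i)) + h (suc k)
  fold zero    h = refl
  fold (suc k) h = begin
    ∑ (suc (2 * suc k)) h
      ≡⟨ cong (λ m → ∑ (suc m) h) (*-suc 2 k) ⟩
    ∑ (2 + 2 * k) h + h (3 + 2 * k)
      ≡⟨ cong (_+ h (3 + 2 * k)) (∑-cons (suc (2 * k)) h) ⟩
    h 1 + ∑ (suc (2 * k)) (h ∘ suc) + h (3 + 2 * k)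
      ≡⟨ cong (λ s → h 1 + s + h (3 + 2 * k)) (fold k (h ∘ suc)) ⟩
    h 1 + (∑[ i ≤ k ] (h (suc i) + h (suc (2 + 2 * k ∸ i))) + h (2 + k)) + h (3 + 2 * k)
      ≡⟨ cong (λ s → h 1 + (s + h (2 + k)) + h (3 + 2 * k)) (∑-cong k inner) ⟩
    h 1 + (∑[ i ≤ k ] (h (suc i) + h (3 + 2 * k ∸ i)) + h (2 + k)) + h (3 + 2 * k)
      ≡⟨ rearrange (h 1) _ (h (2 + k)) (h (3 + 2 * k)) ⟩
    h 1 + h (3 + 2 * k) + ∑[ i ≤ k ] (h (suc i) + h (3 + 2 * k ∸ i)) + h (2 + k)
      ≡⟨ cong (_+ h (2 + k)) (∑-cons k (λ i → h i + h (4 + 2 * k ∸ i))) ⟨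
    ∑[ i ≤ suc k ] (h i + h (4 + 2 * k ∸ i)) + h (2 + k)
      ≡⟨ cong (λ m → ∑[ i ≤ suc k ] (h i + h (2 + m ∸ i)) + h (2 + k)) (*-suc 2 k) ⟨
    ∑[ i ≤ suc k ] (h i + h (2 + 2 * suc k ∸ i)) + h (2 + k) ∎
    where
    open ≡-Reasoning
    inner : ∀ {i} → 1 ≤ i → i ≤ k → h (suc i) + h (suc (2 + 2 * k ∸ i)) ≡ h (suc i) + h (3 + 2 * k ∸ i)
    inner {i} _ i≤k = cong (λ j → h (suc i) + h j)
      (sym (+-∸-assoc 1 {2 + 2 * k} {i} (≤-trans i≤k (≤-trans (m≤n*m k 2) (m≤n+m (2 * k) 2)))))
    rearrange : ∀ a s b c → a + (s + b) + c ≡ a + c + s + b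
    rearrange = solve-∀

∑-odd-pairs : ∀ n f → ∑ (2 * n + 1) f ≡ f 1 + ∑[ p ≤ n ] (f (2 * p) + f (2 * p + 1))
∑-odd-pairs n f rewrite +-comm (2 * n) 1 =
  trans (pairs′ n f) (cong (f 1 +_) (∑-cong n λ {p} _ _ → cong (λ j → f (2 * p) + f j) (+-comm 1 (2 * p))))
  where
  pairs′ : ∀ n f → ∑ (suc (2 * n)) f ≡ f 1 + ∑[ p ≤ n ] (f (2 * p) + f (suc (2 * p)))
  pairs′ zero    f = +-comm 0 (f 1)
  pairs′ (suc n) f = begin
    ∑ (suc (2 * suc n)) f
      ≡⟨ cong (λ m → ∑ (suc m) f) (*-suc 2 n) ⟩
    ∑ (suc (2 * n)) f + f (2 + 2 * n) + f (3 + 2 * n)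
      ≡⟨ cong (λ s → s + f (2 + 2 * n) + f (3 + 2 * n)) (pairs′ n f) ⟩
    f 1 + pairs + f (2 + 2 * n) + f (3 + 2 * n)
      ≡⟨ trans (+-assoc (f 1 + pairs) _ _) (+-assoc (f 1) pairs _) ⟩
    f 1 + (pairs + (f (2 + 2 * n) + f (3 + 2 * n)))
      ≡⟨ cong (λ m → f 1 + (pairs + (f m + f (suc m)))) (*-suc 2 n) ⟨
    f 1 + ∑[ p ≤ suc n ] (f (2 * p) + f (suc (2 * p))) ∎
    where
    open ≡-Reasoning
    pairs : ℕ
    pairs = ∑[ p ≤ n ] (f (2 * p) + f (suc (2 * p)))

sum-map-++ : ∀ {A : Set} (g : A → ℕ) xs ys → sum (map g (xs ++ ys)) ≡ sum (map g xs) + sum (map g ys)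
sum-map-++ g xs ys = trans (cong sum (map-++ g xs ys)) (sum-++ (map g xs) (map g ys))

sum-ones : ∀ {A : Set} (xs : List A) → sum (map (λ _ → 1) xs) ≡ length xs
sum-ones []       = refl
sum-ones (_ ∷ xs) = cong suc (sum-ones xs)

isEven : ℕ → Bool
isEven zero          = true
isEven (suc zero)    = false
isEven (suc (suc m)) = isEven m

isEven-2* : ∀ p → isEven (2 * p) ≡ true
isEven-2* zero    = refl
isEven-2* (suc p) = trans (cong isEven (*-suc 2 p)) (isEven-2* p)

isEven-2*+1 : ∀ p → isEven (2 * p + 1) ≡ false
isEven-2*+1 p rewrite +-comm (2 * p) 1 = lemma p
  where
  lemma : ∀ p → isEven (suc (2 * p)) ≡ false
  lemma zero    = refl
  lemma (suc p) = trans (cong (isEven ∘ suc) (*-suc 2 p)) (lemma p)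

range1⁺ : ∀ {m i} → 1 ≤ i → i ≤ m → i ∈ range1 m
range1⁺ {i = suc i} _ i<m = ∈-map⁺ suc (∈-upTo⁺ i<m)

range1-all : ∀ {P : ℕ → Set} m → (∀ {i} → 1 ≤ i → i ≤ m → P i) → All P (range1 m)
range1-all m P-range = map⁺ (applyUpTo⁺₁ (λ i → i) m (P-range (s≤s z≤n)))

mixed-radix : ∀ R K .{{_ : NonZero K}} {ℓ} → 1 ≤ ℓ → ℓ ≤ R * K →
  ∃₂ λ r c → r < R × 1 ≤ c × c ≤ K × r * K + c ≡ ℓ
mixed-radix R K {suc m} _ m<RK =
  m / K , suc (m % K) , m<n*o⇒m/o<n m<RK , s≤s z≤n , m%n<n m K ,
  trans (+-suc (m / K * K) (m % K)) (cong suc (trans (+-comm (m / K * K) (m % K)) (sym (m≡m%n+[m/n]*n m K))))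

<+1⇒≤ : ∀ {m n} → m < n + 1 → m ≤ n
<+1⇒≤ {m} {n} m<n+1 = m<1+n⇒m≤n (subst (m <_) (+-comm n 1) m<n+1)

<-of-≡+suc : ∀ {a b} d → b ≡ a + suc d → a < b
<-of-≡+suc {a} d b≡ = subst (a <_) (sym b≡) (m<m+n a (s≤s z≤n))

module _ (Γ : Graph) where
  open Graph Γ

  endpointLabel : V → V × V → ℕ → ℕ
  endpointLabel w (a , b) ℓ with (w ≟V a) ⊎-dec (w ≟V b)
  ... | yes _ = ℓ
  ... | no  _ = 0

  endpointLabel-fst : ∀ {w a b} ℓ → w ≡ a → endpointLabel w (a , b) ℓ ≡ ℓ
  endpointLabel-fst {w} {b = b} ℓ refl with (w ≟V w) ⊎-dec (w ≟V b)
  ... | yes _ = refl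
  ... | no w∉ = ⊥-elim (w∉ (inj₁ refl))

  endpointLabel-snd : ∀ {w a b} ℓ → w ≡ b → endpointLabel w (a , b) ℓ ≡ ℓ
  endpointLabel-snd {w} {a} ℓ refl with (w ≟V a) ⊎-dec (w ≟V w)
  ... | yes _ = refl
  ... | no w∉ = ⊥-elim (w∉ (inj₂ refl))

  endpointLabel-other : ∀ {w a b} ℓ → w ≢ a → w ≢ b → endpointLabel w (a , b) ℓ ≡ 0
  endpointLabel-other {w} {a} {b} ℓ w≢a w≢b with (w ≟V a) ⊎-dec (w ≟V b)
  ... | yes (inj₁ w≡a) = ⊥-elim (w≢a w≡a)
  ... | yes (inj₂ w≡b) = ⊥-elim (w≢b w≡b)
  ... | no _ = refl

  -- The left-hand side of term≗ is the local function summed by vsum; it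
  -- cannot be named, so it is left to be inferred from vsum-endpoints.
  mutual
    vsum-endpoints : ∀ f w →
      vsum Γ f w ≡ sum (map (λ e → endpointLabel w (lookup edges e) (label Γ f e)) (allFin (q Γ)))
    vsum-endpoints f w = cong sum (map-cong (term≗ f w) (allFin (q Γ)))

    term≗ : ∀ f w e → _ ≡ endpointLabel w (lookup edges e) (label Γ f e)
    term≗ f w e with (w ≟V proj₁ (lookup edges e)) ⊎-dec (w ≟V proj₂ (lookup edges e))
    ... | yes _ = refl
    ... | no  _ = refl

  module _ (lab : V × V → ℕ)
           (lab-range : ∀ {p} → p ∈ edges → 1 ≤ lab p × lab p ≤ q Γ)
           (lab-onto : ∀ {ℓ} → 1 ≤ ℓ → ℓ ≤ q Γ → ∃ λ p → p ∈ edges × lab p ≡ ℓ) where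

    private
      pred< : ∀ {ℓ} → 1 ≤ ℓ → ℓ ≤ q Γ → pred ℓ < q Γ
      pred< (s≤s z≤n) ℓ≤q = ℓ≤q

      index< : ∀ e → pred (lab (lookup edges e)) < q Γ
      index< e = let r = lab-range (∈-lookup e) in pred< (proj₁ r) (proj₂ r)

      labelIndex : Fin (q Γ) → Fin (q Γ)
      labelIndex e = fromℕ< (index< e)

      labelIndex-onto : StrictlySurjective _≡_ labelIndex
      labelIndex-onto t with lab-onto (s≤s z≤n) (toℕ<n t)
      ... | p , p∈ , lab≡ = index p∈ , toℕ-injective (begin
        toℕ (labelIndex (index p∈))          ≡⟨ toℕ-fromℕ< (index< (index p∈)) ⟩
        pred (lab (lookup edges (index p∈))) ≡⟨ cong (pred ∘ lab) (lookup-index p∈) ⟨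
        pred (lab p)                         ≡⟨ cong pred lab≡ ⟩
        toℕ t                                ∎)
        where open ≡-Reasoning

    labelingFrom : Labeling Γ
    labelingFrom = labelIndex , strictlySurjective⇒bijective labelIndex-onto

    label-labelingFrom : ∀ e → label Γ labelingFrom e ≡ lab (lookup edges e)
    label-labelingFrom e =
      trans (cong suc (toℕ-fromℕ< (index< e))) (suc-pred _ {{>-nonZero (proj₁ (lab-range (∈-lookup e)))}})

    vsum-labelingFrom : ∀ w → vsum Γ labelingFrom w ≡ sum (map (λ p → endpointLabel w p (lab p)) edges)
    vsum-labelingFrom w = begin
      vsum Γ labelingFrom w
        ≡⟨ vsum-endpoints labelingFrom w ⟩
      sum (map (λ e → endpointLabel w (lookup edges e) (label Γ labelingFrom e)) (allFin (q Γ)))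
        ≡⟨ cong sum (map-cong (λ e → cong (endpointLabel w (lookup edges e)) (label-labelingFrom e)) (allFin (q Γ))) ⟩
      sum (map (incident ∘ lookup edges) (allFin (q Γ)))
        ≡⟨ cong sum (map-tabulate (λ e → e) (incident ∘ lookup edges)) ⟩
      sum (tabulate (incident ∘ lookup edges))
        ≡⟨ cong sum (map-tabulate (lookup edges) incident) ⟨
      sum (map incident (tabulate (lookup edges)))
        ≡⟨ cong (sum ∘ map incident) (tabulate-lookup edges) ⟩
      sum (map incident edges) ∎
      where
      open ≡-Reasoning
      incident : V × V → ℕ
      incident p = endpointLabel w p (lab p)

  colorNumber-≤ : ∀ f (cs : List ℕ) → (∀ {w} → w ∈ verts → vsum Γ f w ∈ cs) → colorNumber Γ f ≤ length cs
  colorNumber-≤ f cs sums∈cs = Unique-⊆⇒length≤ (DecUnique.deduplicate-! _≟_ sums) colors⊆cs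
    where
    sums : List ℕ
    sums = map (vsum Γ f) verts
    colors⊆cs : deduplicate _≟_ sums ⊆ cs
    colors⊆cs s∈ with ∈-map⁻ (vsum Γ f) (∈-deduplicate⁻ _≟_ sums s∈)
    ... | _ , w∈ , refl = sums∈cs w∈

  triangle⇒3≤colorNumber : ∀ {a b c} → a ∈ verts → b ∈ verts → c ∈ verts →
    (a , b) ∈ edges → (a , c) ∈ edges → (b , c) ∈ edges →
    ∀ f → IsLocalAntimagic Γ f → 3 ≤ colorNumber Γ f
  triangle⇒3≤colorNumber {a} {b} {c} a∈ b∈ c∈ ab ac bc f antimagic =
    Unique-⊆⇒length≤ ((antimagic ab ∷ antimagic ac ∷ []) ∷ (antimagic bc ∷ []) ∷ [] ∷ []) triangle⊆colors
    where
    color : ∀ {w} → w ∈ verts → vsum Γ f w ∈ deduplicate _≟_ (map (vsum Γ f) verts)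
    color w∈ = ∈-deduplicate⁺ _≟_ (∈-map⁺ (vsum Γ f) w∈)
    triangle⊆colors : vsum Γ f a ∷ vsum Γ f b ∷ vsum Γ f c ∷ [] ⊆ deduplicate _≟_ (map (vsum Γ f) verts)
    triangle⊆colors (here refl) = color a∈
    triangle⊆colors (there (here refl)) = color b∈
    triangle⊆colors (there (there (here refl))) = color c∈

module Construction (n k : ℕ) where

  K N T : ℕ
  K = 2 * k + 1
  N = 2 * n + 1
  T = 2 * k + 2

  mirror : ℕ → ℕ
  mirror a = T ∸ a

  T≡K+1 : T ≡ K + 1
  T≡K+1 = sym (+-assoc (2 * k) 1 1)

  K≤T : K ≤ T
  K≤T = subst (K ≤_) (sym T≡K+1) (m≤m+n K 1)

  k≤T : k ≤ T
  k≤T = ≤-trans (m≤n*m k 2) (m≤m+n (2 * k) 2)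

  k<k+1 : k < k + 1
  k<k+1 = m<m+n k (s≤s z≤n)

  mirror-involutive : ∀ {a} → a ≤ T → mirror (mirror a) ≡ a
  mirror-involutive = m∸[m∸n]≡n

  +-mirror : ∀ {a} → a ≤ T → a + mirror a ≡ T
  +-mirror = m+[n∸m]≡n

  mirror-centre : mirror (k + 1) ≡ k + 1
  mirror-centre = trans (cong (_∸ (k + 1)) (identity k)) (m+n∸n≡m (k + 1) (k + 1))
    where
    identity : ∀ k → 2 * k + 2 ≡ k + 1 + (k + 1)
    identity = solve-∀

  mirror-range : ∀ {a} → 1 ≤ a → a ≤ K → 1 ≤ mirror a × mirror a ≤ K
  mirror-range {a} 1≤a a≤K =
    subst (_≤ T ∸ a) (trans (cong (_∸ K) T≡K+1) (m+n∸m≡n K 1)) (∸-monoʳ-≤ T a≤K) ,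
    subst (T ∸ a ≤_) (trans (cong (_∸ 1) T≡K+1) (m+n∸n≡m K 1)) (∸-monoʳ-≤ T 1≤a)

  mirror-left : ∀ {a} → a ≤ k → k + 1 < mirror a
  mirror-left {a} a≤k =
    subst (_≤ T ∸ a) (trans (cong (_∸ k) (identity k)) (m+n∸m≡n k (suc (k + 1)))) (∸-monoʳ-≤ T a≤k)
    where
    identity : ∀ k → 2 * k + 2 ≡ k + suc (k + 1)
    identity = solve-∀

  mirror-right : ∀ {a} → k + 1 < a → a ≤ K → 1 ≤ mirror a × mirror a ≤ k
  mirror-right {a} k+1<a a≤K =
    proj₁ (mirror-range (≤-trans (s≤s z≤n) k+1<a) a≤K) ,
    subst (T ∸ a ≤_) (trans (cong (_∸ suc (k + 1)) (identity k)) (m+n∸n≡m k (suc (k + 1)))) (∸-monoʳ-≤ T k+1<a)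
    where
    identity : ∀ k → 2 * k + 2 ≡ k + suc (k + 1)
    identity = solve-∀

  centre-range : 1 ≤ k + 1 × k + 1 ≤ K
  centre-range = m≤n+m 1 k , +-monoˡ-≤ 1 (m≤n*m k 2)

  mid : ℕ → ℕ → Vtx
  mid a j with <-cmp a (k + 1)
  ... | tri< _ _ _ = y a j
  ... | tri≈ _ _ _ = x j
  ... | tri> _ _ _ = z (mirror a) j

  mid-left : ∀ {a} j → a ≤ k → mid a j ≡ y a j
  mid-left {a} j a≤k with <-cmp a (k + 1)
  ... | tri< _ _ _   = refl
  ... | tri≈ a≮ _ _  = ⊥-elim (a≮ (≤-<-trans a≤k k<k+1))
  ... | tri> a≮ _ _  = ⊥-elim (a≮ (≤-<-trans a≤k k<k+1))

  mid-centre : ∀ j → mid (k + 1) j ≡ x j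
  mid-centre j with <-cmp (k + 1) (k + 1)
  ... | tri< _ ≢ _ = ⊥-elim (≢ refl)
  ... | tri≈ _ _ _ = refl
  ... | tri> _ ≢ _ = ⊥-elim (≢ refl)

  mid-right : ∀ {a} j → k + 1 < a → mid a j ≡ z (mirror a) j
  mid-right {a} j k+1<a with <-cmp a (k + 1)
  ... | tri< _ _ ≯ = ⊥-elim (≯ k+1<a)
  ... | tri≈ _ _ ≯ = ⊥-elim (≯ k+1<a)
  ... | tri> _ _ _ = refl

  mid-mirror : ∀ {i} j → i ≤ k → mid (mirror i) j ≡ z i j
  mid-mirror {i} j i≤k =
    trans (mid-right j (mirror-left i≤k)) (cong (λ a → z a j) (mirror-involutive (≤-trans i≤k k≤T)))

  mid≢u : ∀ a j {b} → mid a j ≢ u b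
  mid≢u a j with <-cmp a (k + 1)
  ... | tri< _ _ _ = λ ()
  ... | tri≈ _ _ _ = λ ()
  ... | tri> _ _ _ = λ ()

  mid≢v : ∀ a j {b} → mid a j ≢ v b
  mid≢v a j with <-cmp a (k + 1)
  ... | tri< _ _ _ = λ ()
  ... | tri≈ _ _ _ = λ ()
  ... | tri> _ _ _ = λ ()

  column row : Vtx → ℕ
  column (y a _) = a
  column (z i _) = mirror i
  column (x _)   = k + 1
  column _       = 0
  row (y _ j) = j
  row (z _ j) = j
  row (x j)   = j
  row _       = 0

  column-mid : ∀ {a} j → a ≤ T → column (mid a j) ≡ a
  column-mid {a} j a≤T with <-cmp a (k + 1)
  ... | tri< _ _ _    = refl
  ... | tri≈ _ refl _ = refl
  ... | tri> _ _ _    = mirror-involutive a≤T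

  row-mid : ∀ a j → row (mid a j) ≡ j
  row-mid a j with <-cmp a (k + 1)
  ... | tri< _ _ _ = refl
  ... | tri≈ _ _ _ = refl
  ... | tri> _ _ _ = refl

  mid-injective : ∀ {a b j l} → a ≤ T → b ≤ T → mid a j ≡ mid b l → a ≡ b × j ≡ l
  mid-injective {a} {b} {j} {l} a≤T b≤T eq =
    trans (sym (column-mid j a≤T)) (trans (cong column eq) (column-mid l b≤T)) ,
    trans (sym (row-mid a j)) (trans (cong row eq) (row-mid b l))

  cell : ℕ → ℕ → ℕ
  cell r col = r * K + col

  cell-+ : ∀ r col s col′ → cell r col + cell s col′ ≡ cell (r + s) (col + col′)
  cell-+ r col s col′ = identity r col s col′ K
    where
    identity : ∀ r c s d K → r * K + c + (s * K + d) ≡ (r + s) * K + (c + d)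
    identity = solve-∀

  lowLabel highLabel uLabel vLabel : ℕ → ℕ → ℕ
  lowLabel j a  = cell j a
  highLabel j a = cell (2 * N + 1 ∸ j) (mirror a)
  uLabel j a = if isEven j then lowLabel j a else highLabel j a
  vLabel j a = if isEven j then highLabel j a else lowLabel j a

  labels-swap : ∀ j a →
    (lowLabel j a ≡ uLabel j a × highLabel j a ≡ vLabel j a) ⊎
    (lowLabel j a ≡ vLabel j a × highLabel j a ≡ uLabel j a)
  labels-swap j a with isEven j
  ... | true  = inj₁ (refl , refl)
  ... | false = inj₂ (refl , refl)

  lab : Vtx × Vtx → ℕ
  lab (u a , v _) = a
  lab (u _ , w)   = uLabel (row w) (column w)
  lab (v _ , w)   = vLabel (row w) (column w)
  lab _           = 0

  lab-upper : ∀ {a} j → a ≤ T → lab (u a , mid a j) ≡ uLabel j a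
  lab-upper {a} j a≤T with <-cmp a (k + 1)
  ... | tri< _ _ _    = refl
  ... | tri≈ _ refl _ = refl
  ... | tri> _ _ _    = cong (uLabel j) (mirror-involutive a≤T)

  lab-lower : ∀ {a} j b → a ≤ T → lab (v b , mid a j) ≡ vLabel j a
  lab-lower {a} j b a≤T with <-cmp a (k + 1)
  ... | tri< _ _ _    = refl
  ... | tri≈ _ refl _ = refl
  ... | tri> _ _ _    = cong (vLabel j) (mirror-involutive a≤T)

  uSum vSum midSum : ℕ
  uSum   = suc n * cell (2 * N) T
  vSum   = cell 1 T + n * cell (2 * N + 2) T
  midSum = cell (2 * N + 1) T

  lowLabel+highLabel : ∀ {j a} → j ≤ 2 * N + 1 → a ≤ T → lowLabel j a + highLabel j a ≡ midSum
  lowLabel+highLabel {j} {a} j≤2N+1 a≤T =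
    trans (cell-+ j a (2 * N + 1 ∸ j) (mirror a)) (cong₂ cell (m+[n∸m]≡n j≤2N+1) (+-mirror a≤T))

  uLabel+vLabel : ∀ {j a} → j ≤ 2 * N + 1 → a ≤ T → uLabel j a + vLabel j a ≡ midSum
  uLabel+vLabel {j} {a} j≤2N+1 a≤T with isEven j
  ... | true  = lowLabel+highLabel j≤2N+1 a≤T
  ... | false = trans (+-comm (highLabel j a) (lowLabel j a)) (lowLabel+highLabel j≤2N+1 a≤T)

  2p≤2N : ∀ {p} → p ≤ n → 2 * p ≤ 2 * N
  2p≤2N p≤n = *-monoʳ-≤ 2 (≤-trans p≤n (≤-trans (m≤n*m n 2) (m≤m+n (2 * n) 1)))

  upper-pair : ∀ {p a} → p ≤ n → a ≤ T → uLabel (2 * p) a + uLabel (2 * p + 1) a ≡ cell (2 * N) T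
  upper-pair {p} {a} p≤n a≤T rewrite isEven-2* p | isEven-2*+1 p = begin
    cell (2 * p) a + cell (2 * N + 1 ∸ (2 * p + 1)) (mirror a) ≡⟨ cell-+ (2 * p) a _ _ ⟩
    cell (2 * p + (2 * N + 1 ∸ (2 * p + 1))) (a + mirror a)    ≡⟨ cong₂ cell rows (+-mirror a≤T) ⟩
    cell (2 * N) T                                              ∎
    where
    open ≡-Reasoning
    rows : 2 * p + (2 * N + 1 ∸ (2 * p + 1)) ≡ 2 * N
    rows = trans (cong (2 * p +_) (cong₂ _∸_ (+-comm (2 * N) 1) (+-comm (2 * p) 1))) (m+[n∸m]≡n (2p≤2N p≤n))

  lower-pair : ∀ {p a} → p ≤ n → a ≤ T → vLabel (2 * p) a + vLabel (2 * p + 1) a ≡ cell (2 * N + 2) T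
  lower-pair {p} {a} p≤n a≤T rewrite isEven-2* p | isEven-2*+1 p = begin
    cell (2 * N + 1 ∸ 2 * p) (mirror a) + cell (2 * p + 1) a   ≡⟨ cell-+ (2 * N + 1 ∸ 2 * p) (mirror a) (2 * p + 1) a ⟩
    cell (2 * N + 1 ∸ 2 * p + (2 * p + 1)) (mirror a + a)
      ≡⟨ cong₂ cell rows (trans (+-comm (mirror a) a) (+-mirror a≤T)) ⟩
    cell (2 * N + 2) T                                          ∎
    where
    open ≡-Reasoning
    rows : 2 * N + 1 ∸ 2 * p + (2 * p + 1) ≡ 2 * N + 2
    rows = trans (sym (+-assoc (2 * N + 1 ∸ 2 * p) (2 * p) 1))
                 (trans (cong (_+ 1) (m∸n+n≡m (≤-trans (2p≤2N p≤n) (m≤m+n (2 * N) 1)))) (+-assoc (2 * N) 1 1))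

  uLabels-total : ∀ {a} → a ≤ T → a + ∑[ j ≤ N ] uLabel j a ≡ uSum
  uLabels-total {a} a≤T = begin
    a + ∑[ j ≤ N ] uLabel j a
      ≡⟨ cong (a +_) (∑-odd-pairs n (λ j → uLabel j a)) ⟩
    a + (uLabel 1 a + ∑[ p ≤ n ] (uLabel (2 * p) a + uLabel (2 * p + 1) a))
      ≡⟨ cong (λ s → a + (uLabel 1 a + s))
           (trans (∑-cong n λ _ p≤n → upper-pair p≤n a≤T) (∑-const n _)) ⟩
    a + (cell (2 * N + 1 ∸ 1) (mirror a) + n * cell (2 * N) T)
      ≡⟨ +-assoc a (cell (2 * N + 1 ∸ 1) (mirror a)) (n * cell (2 * N) T) ⟨
    a + cell (2 * N + 1 ∸ 1) (mirror a) + n * cell (2 * N) T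
      ≡⟨ cong (_+ n * cell (2 * N) T)
           (trans (cell-+ 0 a (2 * N + 1 ∸ 1) (mirror a)) (cong₂ cell (m+n∸n≡m (2 * N) 1) (+-mirror a≤T))) ⟩
    uSum ∎
    where open ≡-Reasoning

  vLabels-total : ∀ {b} → b ≤ T → b + ∑[ j ≤ N ] vLabel j (mirror b) ≡ vSum
  vLabels-total {b} b≤T = begin
    b + ∑[ j ≤ N ] vLabel j (mirror b)
      ≡⟨ cong (b +_) (∑-odd-pairs n (λ j → vLabel j (mirror b))) ⟩
    b + (vLabel 1 (mirror b) + ∑[ p ≤ n ] (vLabel (2 * p) (mirror b) + vLabel (2 * p + 1) (mirror b)))
      ≡⟨ cong (λ s → b + (vLabel 1 (mirror b) + s))
           (trans (∑-cong n λ _ p≤n → lower-pair p≤n (m∸n≤m T b)) (∑-const n _)) ⟩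
    b + (cell 1 (mirror b) + n * cell (2 * N + 2) T)
      ≡⟨ +-assoc b (cell 1 (mirror b)) (n * cell (2 * N + 2) T) ⟨
    b + cell 1 (mirror b) + n * cell (2 * N + 2) T
      ≡⟨ cong (_+ n * cell (2 * N + 2) T) (trans (cell-+ 0 b 1 (mirror b)) (cong (cell 1) (+-mirror b≤T))) ⟩
    vSum ∎
    where open ≡-Reasoning

  -- The ring solver sees only bound variables, hence the unfolded constants below.
  vSum<uSum : vSum < uSum
  vSum<uSum = <-of-≡+suc _ (identity n k)
    where
    identity : ∀ n k → let K = 2 * k + 1; T = 2 * k + 2; N = 2 * n + 1 in
      suc n * (2 * N * K + T) ≡ 1 * K + T + n * ((2 * N + 2) * K + T) + suc (4 * n * k + 2 * n + 2 * k)
    identity = solve-∀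

  midSum<vSum : 1 ≤ n → midSum < vSum
  midSum<vSum = bound n k
    where
    bound : ∀ n k → 1 ≤ n → let K = 2 * k + 1; T = 2 * k + 2; N = 2 * n + 1 in
      (2 * N + 1) * K + T < 1 * K + T + n * ((2 * N + 2) * K + T)
    bound (suc m) k _ = <-of-≡+suc _ (identity m k)
      where
      identity : ∀ m k → let K = 2 * k + 1; T = 2 * k + 2; N = 2 * suc m + 1 in
        1 * K + T + suc m * ((2 * N + 2) * K + T) ≡ (2 * N + 1) * K + T + suc (6 * k + 3 + m * ((2 * N + 2) * K + T))
      identity = solve-∀

  rungs : List (Vtx × Vtx)
  rungs = map (λ i → (u i , v i)) (range1 K)

  leftBlock : ℕ → ℕ → List (Vtx × Vtx)
  leftBlock i j = (u i , y i j) ∷ (v (mirror i) , y i j) ∷ (v i , z i j) ∷ (u (mirror i) , z i j) ∷ []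

  leftBlocks : List (Vtx × Vtx)
  leftBlocks = concatMap (λ i → concatMap (leftBlock i) (range1 N)) (range1 k)

  centreBlock : ℕ → List (Vtx × Vtx)
  centreBlock j = (u (k + 1) , x j) ∷ (v (k + 1) , x j) ∷ []

  sum-edges : ∀ (g : Vtx × Vtx → ℕ) → sum (map g (GEdges n k)) ≡
    ∑[ a ≤ K ] g (u a , v a) + ∑[ a ≤ K ] ∑[ j ≤ N ] (g (u a , mid a j) + g (v (mirror a) , mid a j))
  sum-edges g = begin
    sum (map g (rungs ++ leftBlocks ++ concatMap centreBlock (range1 N)))
      ≡⟨ trans (sum-map-++ g rungs _) (cong (sum (map g rungs) +_) (sum-map-++ g leftBlocks _)) ⟩
    sum (map g rungs) + (sum (map g leftBlocks) + sum (map g (concatMap centreBlock (range1 N))))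
      ≡⟨ cong₂ _+_ rungs-sum (cong₂ _+_ left-sum centre-sum) ⟩
    ∑[ a ≤ K ] g (u a , v a) + (∑[ i ≤ k ] (spokes i + spokes (mirror i)) + spokes (k + 1))
      ≡⟨ cong (∑[ a ≤ K ] g (u a , v a) +_) (∑-fold k spokes) ⟨
    ∑[ a ≤ K ] g (u a , v a) + ∑ K spokes ∎
    where
    open ≡-Reasoning
    spoke : ℕ → ℕ → ℕ
    spoke a j = g (u a , mid a j) + g (v (mirror a) , mid a j)

    spokes : ℕ → ℕ
    spokes a = ∑[ j ≤ N ] spoke a j

    rungs-sum : sum (map g rungs) ≡ ∑[ a ≤ K ] g (u a , v a)
    rungs-sum = trans (cong sum (sym (map-∘ (range1 K)))) (sum-range1 K _)

    shuffle : ∀ a b c d → a + (b + (c + (d + 0))) ≡ a + b + (d + c)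
    shuffle = solve-∀

    left-block : ∀ {i} j → i ≤ k → sum (map g (leftBlock i j)) ≡ spoke i j + spoke (mirror i) j
    left-block {i} j i≤k
      rewrite mid-left j i≤k | mid-mirror j i≤k | mirror-involutive (≤-trans i≤k k≤T) =
        shuffle (g (u i , y i j)) (g (v (mirror i) , y i j)) (g (v i , z i j)) (g (u (mirror i) , z i j))

    left-sum : sum (map g leftBlocks) ≡ ∑[ i ≤ k ] (spokes i + spokes (mirror i))
    left-sum = trans (trans (sum-concatMap g _ (range1 k)) (sum-range1 k _)) (∑-cong k λ {i} _ i≤k → begin
      sum (map g (concatMap (leftBlock i) (range1 N)))
        ≡⟨ trans (sum-concatMap g (leftBlock i) (range1 N)) (sum-range1 N _) ⟩
      ∑[ j ≤ N ] sum (map g (leftBlock i j))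
        ≡⟨ ∑-cong N (λ {j} _ _ → left-block j i≤k) ⟩
      ∑[ j ≤ N ] (spoke i j + spoke (mirror i) j)
        ≡⟨ ∑-+ N (spoke i) (spoke (mirror i)) ⟩
      spokes i + spokes (mirror i) ∎)

    centre-sum : sum (map g (concatMap centreBlock (range1 N))) ≡ spokes (k + 1)
    centre-sum = begin
      sum (map g (concatMap centreBlock (range1 N)))
        ≡⟨ trans (sum-concatMap g centreBlock (range1 N)) (sum-range1 N _) ⟩
      ∑[ j ≤ N ] (g (u (k + 1) , x j) + (g (v (k + 1) , x j) + 0))
        ≡⟨ ∑-cong N (λ {j} _ _ → centre-block j) ⟩
      spokes (k + 1) ∎
      where
      centre-block : ∀ j → g (u (k + 1) , x j) + (g (v (k + 1) , x j) + 0) ≡ spoke (k + 1) j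
      centre-block j rewrite mid-centre j | mirror-centre = cong (g (u (k + 1) , x j) +_) (+-identityʳ _)

  data Edge : Vtx × Vtx → Set where
    rung  : ∀ {a}   → 1 ≤ a → a ≤ K → Edge (u a , v a)
    upper : ∀ {a j} → 1 ≤ a → a ≤ K → 1 ≤ j → j ≤ N → Edge (u a , mid a j)
    lower : ∀ {a j} → 1 ≤ a → a ≤ K → 1 ≤ j → j ≤ N → Edge (v (mirror a) , mid a j)

  k≤K : k ≤ K
  k≤K = ≤-trans (m≤n*m k 2) (m≤m+n (2 * k) 1)

  all-edges : All Edge (GEdges n k)
  all-edges =
    ++⁺ (map⁺ (range1-all K rung))
        (++⁺ (concat⁺ (map⁺ (range1-all k λ 1≤i i≤k →
                               concat⁺ (map⁺ (range1-all N (left-edges 1≤i i≤k))))))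
             (concat⁺ (map⁺ (range1-all N centre-edges))))
    where
    left-edges : ∀ {i j} → 1 ≤ i → i ≤ k → 1 ≤ j → j ≤ N → All Edge (leftBlock i j)
    left-edges {i} {j} 1≤i i≤k 1≤j j≤N =
        subst (λ w → Edge (u i , w)) (mid-left j i≤k) (upper 1≤i i≤K 1≤j j≤N)
      ∷ subst (λ w → Edge (v (mirror i) , w)) (mid-left j i≤k) (lower 1≤i i≤K 1≤j j≤N)
      ∷ subst Edge (cong₂ _,_ (cong v (mirror-involutive (≤-trans i≤k k≤T))) (mid-mirror j i≤k))
              (lower 1≤mi mi≤K 1≤j j≤N)
      ∷ subst (λ w → Edge (u (mirror i) , w)) (mid-mirror j i≤k) (upper 1≤mi mi≤K 1≤j j≤N)
      ∷ []
      where
      i≤K = ≤-trans i≤k k≤K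
      1≤mi = proj₁ (mirror-range 1≤i i≤K)
      mi≤K = proj₂ (mirror-range 1≤i i≤K)
    centre-edges : ∀ {j} → 1 ≤ j → j ≤ N → All Edge (centreBlock j)
    centre-edges {j} 1≤j j≤N =
        subst (λ w → Edge (u (k + 1) , w)) (mid-centre j) (upper 1≤k+1 k+1≤K 1≤j j≤N)
      ∷ subst Edge (cong₂ _,_ (cong v mirror-centre) (mid-centre j)) (lower 1≤k+1 k+1≤K 1≤j j≤N)
      ∷ []
      where
      1≤k+1 = proj₁ centre-range
      k+1≤K = proj₂ centre-range

  edge-shape : ∀ {p} → p ∈ GEdges n k → Edge p
  edge-shape = All.lookup all-edges

  ∈-rungs : ∀ {a} → 1 ≤ a → a ≤ K → (u a , v a) ∈ GEdges n k
  ∈-rungs 1≤a a≤K = ∈-++⁺ˡ (∈-map⁺ (λ i → (u i , v i)) (range1⁺ 1≤a a≤K))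

  ∈-leftBlock : ∀ {i j p} → 1 ≤ i → i ≤ k → 1 ≤ j → j ≤ N → p ∈ leftBlock i j → p ∈ GEdges n k
  ∈-leftBlock {i} 1≤i i≤k 1≤j j≤N p∈ =
    ∈-++⁺ʳ rungs (∈-++⁺ˡ (∈-concatMap⁺ (λ i → concatMap (leftBlock i) (range1 N))
      (lose (range1⁺ 1≤i i≤k) (∈-concatMap⁺ (leftBlock i) (lose (range1⁺ 1≤j j≤N) p∈)))))

  ∈-centreBlock : ∀ {j p} → 1 ≤ j → j ≤ N → p ∈ centreBlock j → p ∈ GEdges n k
  ∈-centreBlock 1≤j j≤N p∈ =
    ∈-++⁺ʳ rungs (∈-++⁺ʳ leftBlocks (∈-concatMap⁺ centreBlock (lose (range1⁺ 1≤j j≤N) p∈)))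

  edge-∈ : ∀ {p} → Edge p → p ∈ GEdges n k
  edge-∈ (rung 1≤a a≤K) = ∈-rungs 1≤a a≤K
  edge-∈ (upper {a} {j} 1≤a a≤K 1≤j j≤N) with <-cmp a (k + 1)
  ... | tri< a<k+1 _ _ = ∈-leftBlock 1≤a (<+1⇒≤ a<k+1) 1≤j j≤N (here refl)
  ... | tri≈ _ refl _  = ∈-centreBlock 1≤j j≤N (here refl)
  ... | tri> _ _ k+1<a =
    subst (λ b → (u b , z (mirror a) j) ∈ GEdges n k) (mirror-involutive (≤-trans a≤K K≤T))
      (∈-leftBlock (proj₁ (mirror-right k+1<a a≤K)) (proj₂ (mirror-right k+1<a a≤K)) 1≤j j≤N
        (there (there (there (here refl)))))
  edge-∈ (lower {a} {j} 1≤a a≤K 1≤j j≤N) with <-cmp a (k + 1)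
  ... | tri< a<k+1 _ _ = ∈-leftBlock 1≤a (<+1⇒≤ a<k+1) 1≤j j≤N (there (here refl))
  ... | tri≈ _ refl _  =
    subst (λ b → (v b , x j) ∈ GEdges n k) (sym mirror-centre) (∈-centreBlock 1≤j j≤N (there (here refl)))
  ... | tri> _ _ k+1<a =
    ∈-leftBlock (proj₁ (mirror-right k+1<a a≤K)) (proj₂ (mirror-right k+1<a a≤K)) 1≤j j≤N
      (there (there (here refl)))

  data Vertex : Vtx → Set where
    upperEnd : ∀ {a}   → 1 ≤ a → a ≤ K → Vertex (u a)
    lowerEnd : ∀ {a}   → 1 ≤ a → a ≤ K → Vertex (v a)
    middle   : ∀ {a j} → 1 ≤ a → a ≤ K → 1 ≤ j → j ≤ N → Vertex (mid a j)

  all-vertices : All Vertex (GVerts n k)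
  all-vertices =
    ++⁺ (concat⁺ (map⁺ (range1-all K λ 1≤a a≤K → upperEnd 1≤a a≤K ∷ lowerEnd 1≤a a≤K ∷ [])))
        (++⁺ (concat⁺ (map⁺ (range1-all k λ 1≤i i≤k →
                               concat⁺ (map⁺ (range1-all N (left-vertices 1≤i i≤k))))))
             (map⁺ (range1-all N λ 1≤j j≤N →
                      subst Vertex (mid-centre _) (middle (proj₁ centre-range) (proj₂ centre-range) 1≤j j≤N))))
    where
    left-vertices : ∀ {i j} → 1 ≤ i → i ≤ k → 1 ≤ j → j ≤ N → All Vertex (y i j ∷ z i j ∷ [])
    left-vertices {i} {j} 1≤i i≤k 1≤j j≤N =
        subst Vertex (mid-left j i≤k) (middle 1≤i (≤-trans i≤k k≤K) 1≤j j≤N)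
      ∷ subst Vertex (mid-mirror j i≤k) (middle (proj₁ m-range) (proj₂ m-range) 1≤j j≤N)
      ∷ []
      where
      m-range = mirror-range 1≤i (≤-trans i≤k k≤K)

  vertex-shape : ∀ {w} → w ∈ GVerts n k → Vertex w
  vertex-shape = All.lookup all-vertices

  InTable : ℕ → Set
  InTable ℓ = 1 ≤ ℓ × ℓ ≤ (2 * N + 1) * K

  cell-inTable : ∀ {r col} → r ≤ 2 * N → 1 ≤ col → col ≤ K → InTable (cell r col)
  cell-inTable {r} {col} r≤2N 1≤col col≤K =
    ≤-trans 1≤col (m≤n+m col (r * K)) ,
    ≤-trans (+-mono-≤ (*-monoˡ-≤ K r≤2N) col≤K) (≤-reflexive (identity (2 * N) K))
    where
    identity : ∀ M K → M * K + K ≡ (M + 1) * K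
    identity = solve-∀

  low-inTable : ∀ {a j} → 1 ≤ a → a ≤ K → 1 ≤ j → j ≤ N → InTable (lowLabel j a)
  low-inTable 1≤a a≤K _ j≤N = cell-inTable (≤-trans j≤N (m≤n*m N 2)) 1≤a a≤K

  high-inTable : ∀ {a j} → 1 ≤ a → a ≤ K → 1 ≤ j → j ≤ N → InTable (highLabel j a)
  high-inTable {j = j} 1≤a a≤K 1≤j _ =
    cell-inTable (subst (2 * N + 1 ∸ j ≤_) (m+n∸n≡m (2 * N) 1) (∸-monoʳ-≤ (2 * N + 1) 1≤j))
                 (proj₁ (mirror-range 1≤a a≤K)) (proj₂ (mirror-range 1≤a a≤K))

  labels-inTable : ∀ {a j} → 1 ≤ a → a ≤ K → 1 ≤ j → j ≤ N → InTable (uLabel j a) × InTable (vLabel j a)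
  labels-inTable {a} {j} 1≤a a≤K 1≤j j≤N with labels-swap j a
  ... | inj₁ (l≡u , h≡v) =
    subst InTable l≡u (low-inTable 1≤a a≤K 1≤j j≤N) , subst InTable h≡v (high-inTable 1≤a a≤K 1≤j j≤N)
  ... | inj₂ (l≡v , h≡u) =
    subst InTable h≡u (high-inTable 1≤a a≤K 1≤j j≤N) , subst InTable l≡v (low-inTable 1≤a a≤K 1≤j j≤N)

  edge-inTable : ∀ {p} → Edge p → InTable (lab p)
  edge-inTable (rung 1≤a a≤K) = cell-inTable z≤n 1≤a a≤K
  edge-inTable (upper {a} {j} 1≤a a≤K 1≤j j≤N) =
    subst InTable (sym (lab-upper j (≤-trans a≤K K≤T))) (proj₁ (labels-inTable 1≤a a≤K 1≤j j≤N))
  edge-inTable (lower {a} {j} 1≤a a≤K 1≤j j≤N) =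
    subst InTable (sym (lab-lower j (mirror a) (≤-trans a≤K K≤T))) (proj₂ (labels-inTable 1≤a a≤K 1≤j j≤N))

  IsEdgeLabel : ℕ → Set
  IsEdgeLabel ℓ = ∃ λ p → p ∈ GEdges n k × lab p ≡ ℓ

  uLabel-isEdgeLabel : ∀ {a j} → 1 ≤ a → a ≤ K → 1 ≤ j → j ≤ N → IsEdgeLabel (uLabel j a)
  uLabel-isEdgeLabel {a} {j} 1≤a a≤K 1≤j j≤N =
    (u a , mid a j) , edge-∈ (upper 1≤a a≤K 1≤j j≤N) , lab-upper j (≤-trans a≤K K≤T)

  vLabel-isEdgeLabel : ∀ {a j} → 1 ≤ a → a ≤ K → 1 ≤ j → j ≤ N → IsEdgeLabel (vLabel j a)
  vLabel-isEdgeLabel {a} {j} 1≤a a≤K 1≤j j≤N =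
    (v (mirror a) , mid a j) , edge-∈ (lower 1≤a a≤K 1≤j j≤N) , lab-lower j (mirror a) (≤-trans a≤K K≤T)

  lowHigh-isEdgeLabel : ∀ {a j} → 1 ≤ a → a ≤ K → 1 ≤ j → j ≤ N →
    IsEdgeLabel (lowLabel j a) × IsEdgeLabel (highLabel j a)
  lowHigh-isEdgeLabel {a} {j} 1≤a a≤K 1≤j j≤N with labels-swap j a
  ... | inj₁ (l≡u , h≡v) =
    subst IsEdgeLabel (sym l≡u) (uLabel-isEdgeLabel 1≤a a≤K 1≤j j≤N) ,
    subst IsEdgeLabel (sym h≡v) (vLabel-isEdgeLabel 1≤a a≤K 1≤j j≤N)
  ... | inj₂ (l≡v , h≡u) =
    subst IsEdgeLabel (sym l≡v) (vLabel-isEdgeLabel 1≤a a≤K 1≤j j≤N) ,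
    subst IsEdgeLabel (sym h≡u) (uLabel-isEdgeLabel 1≤a a≤K 1≤j j≤N)

  cell-isEdgeLabel : ∀ {r col} → r ≤ 2 * N → 1 ≤ col → col ≤ K → IsEdgeLabel (cell r col)
  cell-isEdgeLabel {zero} {col} _ 1≤col col≤K = (u col , v col) , ∈-rungs 1≤col col≤K , refl
  cell-isEdgeLabel {suc r} {col} 1+r≤2N 1≤col col≤K with suc r ≤? N
  ... | yes 1+r≤N = proj₁ (lowHigh-isEdgeLabel 1≤col col≤K (s≤s z≤n) 1+r≤N)
  ... | no 1+r≰N = subst IsEdgeLabel high≡cell (proj₂ (lowHigh-isEdgeLabel 1≤mcol mcol≤K 1≤j j≤N))
    where
    j = 2 * N + 1 ∸ suc r
    1+r<2N+1 : suc r < 2 * N + 1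
    1+r<2N+1 = ≤-<-trans 1+r≤2N (m<m+n (2 * N) (s≤s z≤n))
    1≤j : 1 ≤ j
    1≤j = m<n⇒0<n∸m 1+r<2N+1
    j≤N : j ≤ N
    j≤N = ≤-trans (∸-monoʳ-≤ (2 * N + 1) (≰⇒> 1+r≰N))
                  (≤-reflexive (trans (cong (_∸ suc N) (identity N)) (m+n∸n≡m N (suc N))))
      where
      identity : ∀ N → 2 * N + 1 ≡ N + suc N
      identity = solve-∀
    1≤mcol = proj₁ (mirror-range 1≤col col≤K)
    mcol≤K = proj₂ (mirror-range 1≤col col≤K)
    high≡cell : highLabel j (mirror col) ≡ cell (suc r) col
    high≡cell = cong₂ cell (m∸[m∸n]≡n (<⇒≤ 1+r<2N+1)) (mirror-involutive (≤-trans col≤K K≤T))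

  instance
    K-nonZero : NonZero K
    K-nonZero = >-nonZero (m≤n+m 1 (2 * k))

  inTable⇒isEdgeLabel : ∀ {ℓ} → InTable ℓ → IsEdgeLabel ℓ
  inTable⇒isEdgeLabel (1≤ℓ , ℓ≤) with mixed-radix (2 * N + 1) K 1≤ℓ ℓ≤
  ... | r , col , r<2N+1 , 1≤col , col≤K , refl = cell-isEdgeLabel (<+1⇒≤ r<2N+1) 1≤col col≤K

  edges-count : q (G n k) ≡ (2 * N + 1) * K
  edges-count = begin
    length (GEdges n k)                          ≡⟨ sum-ones (GEdges n k) ⟨
    sum (map (λ _ → 1) (GEdges n k))             ≡⟨ sum-edges (λ _ → 1) ⟩
    ∑[ a ≤ K ] 1 + ∑[ a ≤ K ] ∑[ j ≤ N ] 2
      ≡⟨ cong₂ _+_ (∑-const K 1) (trans (∑-cong K λ _ _ → ∑-const N 2) (∑-const K (N * 2))) ⟩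
    K * 1 + K * (N * 2)                          ≡⟨ identity N K ⟩
    (2 * N + 1) * K                              ∎
    where
    open ≡-Reasoning
    identity : ∀ N K → K * 1 + K * (N * 2) ≡ (2 * N + 1) * K
    identity = solve-∀

  lab-range : ∀ {p} → p ∈ GEdges n k → 1 ≤ lab p × lab p ≤ q (G n k)
  lab-range {p} p∈ = subst (λ Q → 1 ≤ lab p × lab p ≤ Q) (sym edges-count) (edge-inTable (edge-shape p∈))

  lab-onto : ∀ {ℓ} → 1 ≤ ℓ → ℓ ≤ q (G n k) → IsEdgeLabel ℓ
  lab-onto {ℓ} 1≤ℓ ℓ≤q = inTable⇒isEdgeLabel (1≤ℓ , subst (ℓ ≤_) edges-count ℓ≤q)

  labeling : Labeling (G n k)
  labeling = labelingFrom (G n k) lab lab-range lab-onto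

  -- Opaque, so that the incident-* lemmas are found by unifying vertex and edge
  -- instead of unfolding the decision procedure for Vtx.
  opaque
    incident : Vtx → Vtx × Vtx → ℕ
    incident w p = endpointLabel (G n k) w p (lab p)

    incident-fst : ∀ {w a b} → w ≡ a → incident w (a , b) ≡ lab (a , b)
    incident-fst {b = b} w≡a = endpointLabel-fst (G n k) {b = b} _ w≡a

    incident-snd : ∀ {w a b} → w ≡ b → incident w (a , b) ≡ lab (a , b)
    incident-snd {a = a} w≡b = endpointLabel-snd (G n k) {a = a} _ w≡b

    incident-other : ∀ {w a b} → w ≢ a → w ≢ b → incident w (a , b) ≡ 0
    incident-other = endpointLabel-other (G n k) _

    vsum-spokes : ∀ w → vsum (G n k) labeling w ≡
      ∑[ a ≤ K ] incident w (u a , v a) +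
      ∑[ a ≤ K ] ∑[ j ≤ N ] (incident w (u a , mid a j) + incident w (v (mirror a) , mid a j))
    vsum-spokes w = trans (vsum-labelingFrom (G n k) lab lab-range lab-onto w) (sum-edges (incident w))

  u-injective : ∀ {a b} → u a ≡ u b → a ≡ b
  u-injective refl = refl

  v-injective : ∀ {a b} → v a ≡ v b → a ≡ b
  v-injective refl = refl

  vsum-upperEnd : ∀ {b} → 1 ≤ b → b ≤ K → vsum (G n k) labeling (u b) ≡ uSum
  vsum-upperEnd {b} 1≤b b≤K =
    trans (vsum-spokes (u b)) (trans (cong₂ _+_ rung-sum spoke-sum) (uLabels-total (≤-trans b≤K K≤T)))
    where
    rung-sum : ∑[ a ≤ K ] incident (u b) (u a , v a) ≡ b
    rung-sum = trans (∑-single K 1≤b b≤K λ _ _ a≢b → incident-other (λ eq → a≢b (sym (u-injective eq))) λ ())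
                     (incident-fst refl)
    spoke-sum : ∑[ a ≤ K ] ∑[ j ≤ N ] (incident (u b) (u a , mid a j) + incident (u b) (v (mirror a) , mid a j)) ≡
                ∑[ j ≤ N ] uLabel j b
    spoke-sum = trans
      (∑-single K 1≤b b≤K λ {a} _ _ a≢b → ∑-zero N λ {j} _ _ → cong₂ _+_
        (incident-other (λ eq → a≢b (sym (u-injective eq))) (λ eq → mid≢u a j (sym eq)))
        (incident-other (λ ()) (λ eq → mid≢u a j (sym eq))))
      (∑-cong N λ {j} _ _ → trans
        (cong₂ _+_ (trans (incident-fst refl) (lab-upper j (≤-trans b≤K K≤T)))
                   (incident-other (λ ()) (λ eq → mid≢u b j (sym eq))))
        (+-identityʳ _))

  vsum-lowerEnd : ∀ {b} → 1 ≤ b → b ≤ K → vsum (G n k) labeling (v b) ≡ vSum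
  vsum-lowerEnd {b} 1≤b b≤K =
    trans (vsum-spokes (v b)) (trans (cong₂ _+_ rung-sum spoke-sum) (vLabels-total b≤T))
    where
    b≤T = ≤-trans b≤K K≤T
    rung-sum : ∑[ a ≤ K ] incident (v b) (u a , v a) ≡ b
    rung-sum = trans (∑-single K 1≤b b≤K λ _ _ a≢b → incident-other (λ ()) (λ eq → a≢b (sym (v-injective eq))))
                     (incident-snd refl)
    spoke-sum : ∑[ a ≤ K ] ∑[ j ≤ N ] (incident (v b) (u a , mid a j) + incident (v b) (v (mirror a) , mid a j)) ≡
                ∑[ j ≤ N ] vLabel j (mirror b)
    spoke-sum = trans
      (∑-single K (proj₁ (mirror-range 1≤b b≤K)) (proj₂ (mirror-range 1≤b b≤K)) λ {a} _ a≤K a≢ →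
        ∑-zero N λ {j} _ _ → cong₂ _+_
          (incident-other (λ ()) (λ eq → mid≢v a j (sym eq)))
          (incident-other
            (λ vb≡ → a≢ (trans (sym (mirror-involutive (≤-trans a≤K K≤T))) (cong mirror (sym (v-injective vb≡)))))
            (λ eq → mid≢v a j (sym eq))))
      (∑-cong N λ {j} _ _ → cong₂ _+_
        (incident-other (λ ()) (λ eq → mid≢v (mirror b) j (sym eq)))
        (trans (incident-fst (cong v (sym (mirror-involutive b≤T)))) (lab-lower j b (m∸n≤m T b))))

  vsum-middle : ∀ {b l} → 1 ≤ b → b ≤ K → 1 ≤ l → l ≤ N → vsum (G n k) labeling (mid b l) ≡ midSum
  vsum-middle {b} {l} 1≤b b≤K 1≤l l≤N =
    trans (vsum-spokes (mid b l)) (cong₂ _+_ rung-sum spoke-sum)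
    where
    b≤T = ≤-trans b≤K K≤T
    rung-sum : ∑[ a ≤ K ] incident (mid b l) (u a , v a) ≡ 0
    rung-sum = ∑-zero K λ _ _ → incident-other (mid≢u b l) (mid≢v b l)
    spoke-sum : ∑[ a ≤ K ] ∑[ j ≤ N ] (incident (mid b l) (u a , mid a j) + incident (mid b l) (v (mirror a) , mid a j)) ≡
                midSum
    spoke-sum = trans
      (∑-single K 1≤b b≤K λ {a} _ a≤K a≢b → ∑-zero N λ {j} _ _ →
        let b,l≢a,j = λ eq → a≢b (sym (proj₁ (mid-injective b≤T (≤-trans a≤K K≤T) eq))) in
        cong₂ _+_ (incident-other (mid≢u b l) b,l≢a,j)
                  (incident-other (mid≢v b l) b,l≢a,j))
      (trans
        (∑-single N 1≤l l≤N λ {j} _ _ j≢l →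
          let b,l≢b,j = λ eq → j≢l (sym (proj₂ (mid-injective b≤T b≤T eq))) in
          cong₂ _+_ (incident-other (mid≢u b l) b,l≢b,j)
                    (incident-other (mid≢v b l) b,l≢b,j))
        (trans
          (cong₂ _+_ (trans (incident-snd refl) (lab-upper l b≤T))
                     (trans (incident-snd refl) (lab-lower l (mirror b) b≤T)))
          (uLabel+vLabel (≤-trans l≤N (≤-trans (m≤n*m N 2) (m≤m+n (2 * N) 1))) b≤T)))

  edge-antimagic : 1 ≤ n → ∀ {p} → Edge p →
    vsum (G n k) labeling (proj₁ p) ≢ vsum (G n k) labeling (proj₂ p)
  edge-antimagic _ (rung 1≤a a≤K) =
    subst₂ _≢_ (sym (vsum-upperEnd 1≤a a≤K)) (sym (vsum-lowerEnd 1≤a a≤K)) (>⇒≢ vSum<uSum)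
  edge-antimagic 1≤n (upper 1≤a a≤K 1≤j j≤N) =
    subst₂ _≢_ (sym (vsum-upperEnd 1≤a a≤K)) (sym (vsum-middle 1≤a a≤K 1≤j j≤N))
               (>⇒≢ (<-trans (midSum<vSum 1≤n) vSum<uSum))
  edge-antimagic 1≤n (lower 1≤a a≤K 1≤j j≤N) =
    subst₂ _≢_ (sym (vsum-lowerEnd (proj₁ (mirror-range 1≤a a≤K)) (proj₂ (mirror-range 1≤a a≤K))))
               (sym (vsum-middle 1≤a a≤K 1≤j j≤N)) (>⇒≢ (midSum<vSum 1≤n))

  labeling-antimagic : 1 ≤ n → IsLocalAntimagic (G n k) labeling
  labeling-antimagic 1≤n p∈ = edge-antimagic 1≤n (edge-shape p∈)

  vertex-color : ∀ {w} → Vertex w → vsum (G n k) labeling w ∈ uSum ∷ vSum ∷ midSum ∷ []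
  vertex-color (upperEnd 1≤a a≤K)       = here (vsum-upperEnd 1≤a a≤K)
  vertex-color (lowerEnd 1≤a a≤K)       = there (here (vsum-lowerEnd 1≤a a≤K))
  vertex-color (middle 1≤a a≤K 1≤j j≤N) = there (there (here (vsum-middle 1≤a a≤K 1≤j j≤N)))

  labeling-colors : ∀ {w} → w ∈ GVerts n k → vsum (G n k) labeling w ∈ uSum ∷ vSum ∷ midSum ∷ []
  labeling-colors w∈ = vertex-color (vertex-shape w∈)

  at-least-three-colors : ∀ f → IsLocalAntimagic (G n k) f → 3 ≤ colorNumber (G n k) f
  at-least-three-colors = triangle⇒3≤colorNumber (G n k)
    (∈-++⁺ˡ (∈-concatMap⁺ (λ i → u i ∷ v i ∷ []) (lose (range1⁺ 1≤k+1 k+1≤K) (here refl))))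
    (∈-++⁺ˡ (∈-concatMap⁺ (λ i → u i ∷ v i ∷ []) (lose (range1⁺ 1≤k+1 k+1≤K) (there (here refl)))))
    (∈-++⁺ʳ ends (∈-++⁺ʳ leftMiddles (∈-map⁺ x (range1⁺ ≤-refl 1≤N))))
    (∈-rungs 1≤k+1 k+1≤K)
    (∈-centreBlock ≤-refl 1≤N (here refl))
    (∈-centreBlock ≤-refl 1≤N (there (here refl)))
    where
    ends leftMiddles : List Vtx
    ends = concatMap (λ i → u i ∷ v i ∷ []) (range1 K)
    leftMiddles = concatMap (λ i → concatMap (λ j → y i j ∷ z i j ∷ []) (range1 N)) (range1 k)
    1≤k+1 = proj₁ centre-range
    k+1≤K = proj₂ centre-range
    1≤N : 1 ≤ N
    1≤N = m≤n+m 1 (2 * n)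

theorem3p1 : (n k : ℕ) → 1 ≤ n → 1 ≤ k → ChiLA≡ (G n k) 3
theorem3p1 n k 1≤n _ =
  ( labeling
  , labeling-antimagic 1≤n
  , ≤-antisym (colorNumber-≤ (G n k) labeling (uSum ∷ vSum ∷ midSum ∷ []) labeling-colors)
              (at-least-three-colors labeling (labeling-antimagic 1≤n)))
  , at-least-three-colors
  where open Construction n k
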